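{- Let $R$ be a complete discrete valuation ring with maximal ideal $\mathfrak{p}=pR$ and field of fractions $F$. Fix $n\ge1$, $\gamma=\begin{pmatrix}0&1\\ p^n&0\end{pmatrix}$, $\mathcal{O}=\operatorname{M}_2(R)\cap\gamma^{ -1}\operatorname{M}_2(R)\gamma=\begin{pmatrix}R&R\\ \mathfrak{p}^n&R\end{pmatrix}$, and let $\operatorname{rad}(\mathcal{O})$ be its Jacobson radical. Suppose $\operatorname{rad}(\mathcal{O})\in\operatorname{Id}(\mathcal{O};\mathfrak{p})$. Then $\operatorname{rad}(\mathcal{O})$ corresponds, under the bijection $\mathcal{O}\alpha\mapsto([L_0\alpha],[L_0\gamma\alpha])$ ($\alpha\in\mathcal{O}$, $\operatorname{nrd}(\alpha)=p$), to the segment associated to $\mathcal{O}$ itself, namely the one with endpoints $[L_0]$ and $[L_0\gamma]$; and $\sigma_\omega(\operatorname{rad}(\mathcal{O}))=\operatorname{rad}(\mathcal{O})\omega=\operatorname{rad}(\mathcal{O})$ for every $\omega\in\mathcal{O}^\times$.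
   Context: $\operatorname{Id}(\mathcal{O};\mathfrak{p})$ is the set of principal left ideals of $\mathcal{O}$ of reduced norm $\mathfrak{p}$ (reduced norm $\operatorname{nrd}=\det$); each is $\mathcal{O}\alpha$ with $\alpha\in\mathcal{O}$, $\operatorname{nrd}(\alpha)=p$. For $\omega\in\mathcal{O}^\times$, $\sigma_\omega(P)=P\omega$. $V=F^2$ (row vectors) with right action of $\operatorname{M}_2(F)$, $L_0=R^2$; vertices of the Bruhat–Tits tree are homothety classes $[L]$ of full $R$-lattices in $V$ ($L\sim La$, $a\in F^\times$), with edges between classes having representatives $pL_1\subsetneq L_2\subsetneq L_1$; the segment associated to an Eichler order $\operatorname{End}_R(L_1)\cap\operatorname{End}_R(L_2)$ is the path between $[L_1]$ and $[L_2]$. -}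

module Defs where

open import Level using (Level; _⊔_; suc)
open import Data.Nat using (ℕ; zero; _≤_) renaming (suc to sucℕ)
open import Data.Product using (Σ; ∃; _×_; _,_)
open import Data.Sum using (_⊎_)
open import Relation.Nullary using (¬_)
open import Algebra.Bundles using (CommutativeRing)

module Pow {c ℓ} (F : CommutativeRing c ℓ) where
  open CommutativeRing F
  infixr 8 _^_
  _^_ : Carrier → ℕ → Carrier
  x ^ zero = 1#
  x ^ sucℕ k = x * (x ^ k)

DivR : ∀ {c ℓ} (F : CommutativeRing c ℓ) → (CommutativeRing.Carrier F → Set (c ⊔ ℓ)) →
       CommutativeRing.Carrier F → CommutativeRing.Carrier F → Set (c ⊔ ℓ)
DivR F inR x y = ∃ λ z → inR z × y ≈ x * z
  where open CommutativeRing F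

-- A complete discrete valuation ring R, given as a subring of its field of fractions F,
-- with uniformizer p (so the maximal ideal is 𝔭 = pR).
record CDVR (c ℓ : Level) : Set (suc (c ⊔ ℓ)) where
  field
    F : CommutativeRing c ℓ
  open CommutativeRing F public
  open Pow F public
  field
    1≉0     : ¬ (1# ≈ 0#)
    inverse : ∀ x → ¬ (x ≈ 0#) → ∃ λ y → x * y ≈ 1#
    inR      : Carrier → Set (c ⊔ ℓ)
    inR-resp : ∀ {x y} → x ≈ y → inR x → inR y
    inR-0    : inR 0#
    inR-1    : inR 1#
    inR-+    : ∀ {x y} → inR x → inR y → inR (x + y)
    inR-neg  : ∀ {x} → inR x → inR (- x)
    inR-*    : ∀ {x y} → inR x → inR y → inR (x * y)
    fractions : ∀ f → ∃ λ a → ∃ λ b → inR a × inR b × ¬ (b ≈ 0#) × f * b ≈ a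
    p        : Carrier
    inR-p    : inR p
    p≉0      : ¬ (p ≈ 0#)
    p-nonunit : ¬ (∃ λ y → inR y × p * y ≈ 1#)
    factor   : ∀ x → inR x → ¬ (x ≈ 0#) →
               ∃ λ k → ∃ λ u → inR u × (∃ λ v → inR v × u * v ≈ 1#) × x ≈ u * (p ^ k)
    complete : ∀ (s : ℕ → Carrier) → (∀ i → inR (s i)) →
               (∀ k → ∃ λ N → ∀ i j → N ≤ i → N ≤ j → DivR F inR (p ^ k) (s i - s j)) →
               ∃ λ x → inR x × (∀ k → ∃ λ N → ∀ i → N ≤ i → DivR F inR (p ^ k) (s i - x))

module Setup {c ℓ : Level} (S : CDVR c ℓ) (n : ℕ) where
  open CDVR S public

  _∣R_ : Carrier → Carrier → Set (c ⊔ ℓ)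
  _∣R_ = DivR F inR

  record M2 : Set c where
    constructor mat
    field a b c' d : Carrier
  open M2 public

  _≈M_ : M2 → M2 → Set ℓ
  mat a₁ b₁ c₁ d₁ ≈M mat a₂ b₂ c₂ d₂ = a₁ ≈ a₂ × b₁ ≈ b₂ × c₁ ≈ c₂ × d₁ ≈ d₂

  _*M_ : M2 → M2 → M2
  mat a₁ b₁ c₁ d₁ *M mat a₂ b₂ c₂ d₂ =
    mat (a₁ * a₂ + b₁ * c₂) (a₁ * b₂ + b₁ * d₂) (c₁ * a₂ + d₁ * c₂) (c₁ * b₂ + d₁ * d₂)

  _+M_ : M2 → M2 → M2
  mat a₁ b₁ c₁ d₁ +M mat a₂ b₂ c₂ d₂ = mat (a₁ + a₂) (b₁ + b₂) (c₁ + c₂) (d₁ + d₂)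

  0M 1M : M2
  0M = mat 0# 0# 0# 0#
  1M = mat 1# 0# 0# 1#

  nrd : M2 → Carrier
  nrd (mat a b c d) = a * d - b * c

  γ : M2
  γ = mat 0# 1# (p ^ n) 0#

  inO : M2 → Set (c ⊔ ℓ)
  inO (mat a b c d) = inR a × inR b × (p ^ n) ∣R c × inR d

  unitO : M2 → Set (c ⊔ ℓ)
  unitO ω = inO ω × ∃ λ ω' → inO ω' × (ω *M ω') ≈M 1M × (ω' *M ω) ≈M 1M

  SubM : (k : Level) → Set (c ⊔ suc k)
  SubM k = M2 → Set k

  _≐_ : ∀ {k k'} → SubM k → SubM k' → Set (c ⊔ k ⊔ k')
  P ≐ Q = ∀ x → (P x → Q x) × (Q x → P x)

  LeftIdeal : SubM (c ⊔ ℓ) → Set (c ⊔ ℓ)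
  LeftIdeal I = (∀ x → I x → inO x)
              × (∀ x y → x ≈M y → I x → I y)
              × I 0M
              × (∀ x y → I x → I y → I (x +M y))
              × (∀ r x → inO r → I x → I (r *M x))

  MaximalLeftIdeal : SubM (c ⊔ ℓ) → Set (suc (c ⊔ ℓ))
  MaximalLeftIdeal I = LeftIdeal I × ¬ I 1M
                     × (∀ J → LeftIdeal J → (∀ x → I x → J x) → (J ≐ I) ⊎ J 1M)

  rad : SubM (suc (c ⊔ ℓ))
  rad x = inO x × (∀ I → MaximalLeftIdeal I → I x)

  Oα : M2 → SubM (c ⊔ ℓ)
  Oα α x = ∃ λ β → inO β × x ≈M (β *M α)

  GeneratesWithNormP : ∀ {k} → SubM k → M2 → Set (c ⊔ ℓ ⊔ k)
  GeneratesWithNormP P α = inO α × nrd α ≈ p × (P ≐ Oα α)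

  InId : ∀ {k} → SubM k → Set (c ⊔ ℓ ⊔ k)
  InId P = ∃ λ α → GeneratesWithNormP P α

  σ : ∀ {k} → M2 → SubM k → SubM (c ⊔ ℓ ⊔ k)
  σ ω P x = ∃ λ y → P y × x ≈M (y *M ω)

  V : Set c
  V = Carrier × Carrier

  _≈V_ : V → V → Set ℓ
  (x₁ , y₁) ≈V (x₂ , y₂) = x₁ ≈ x₂ × y₁ ≈ y₂

  _·_ : V → M2 → V
  (x , y) · mat a b c d = (x * a + y * c , x * b + y * d)

  _·s_ : V → Carrier → V
  (x , y) ·s t = (x * t , y * t)

  Lat : Set (suc (c ⊔ ℓ))
  Lat = V → Set (c ⊔ ℓ)

  L₀ : Lat
  L₀ (x , y) = inR x × inR y

  _·L_ : Lat → M2 → Lat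
  (L ·L M) w = ∃ λ v → L v × w ≈V (v · M)

  SameClass : Lat → Lat → Set (c ⊔ ℓ)
  SameClass L L' = ∃ λ t → ¬ (t ≈ 0#) × (∀ w → (L' w → ∃ λ v → L v × w ≈V (v ·s t))
                                             × ((∃ λ v → L v × w ≈V (v ·s t)) → L' w))

  SameSegment : Lat → Lat → Lat → Lat → Set (c ⊔ ℓ)
  SameSegment L₁ L₂ L₃ L₄ = (SameClass L₁ L₃ × SameClass L₂ L₄)
                          ⊎ (SameClass L₁ L₄ × SameClass L₂ L₃)

  CorrespondsToOwnSegment : M2 → Set (c ⊔ ℓ)
  CorrespondsToOwnSegment α = SameSegment (L₀ ·L α) (L₀ ·L (γ *M α)) L₀ (L₀ ·L γ)

-- Invariance under units is general: right multiplication by ω ∈ 𝒪× permutes the maximal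
-- left ideals of 𝒪, hence fixes their intersection rad(𝒪).
--
-- For the segment we identify a generator α.  Using the criterion "x ∈ rad(𝒪) if 1 + r x is
-- left invertible for all r ∈ 𝒪" together with "an element of 𝒪 whose reduced norm is a unit
-- of R is invertible (inverse nrd⁻¹·adj)", the matrices e₁ = (0 1 ; 0 0) and e₂ = (0 0 ; pⁿ 0)
-- lie in rad(𝒪) = 𝒪α.  Multiplying e₁ = βα and e₂ = β'α by adj α yields the shape
-- α = (a'p  b ; pⁿc₀  d'p), and nrd α = p becomes p a'd' − b pⁿ⁻¹ c₀ = 1.  For n ≥ 2 this puts
-- 1 in 𝔭, so no such α exists.  For n = 1 it factors α = εγ and γα = δ·p with ε, δ ∈ 𝒪×, and
-- since units of 𝒪 fix L₀ we get L₀α = L₀γ and L₀γα = pL₀ ∈ [L₀].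
module Submission where

open import Defs
open import Algebra.Bundles using (CommutativeRing; RawRing)
open import Algebra.Solver.Ring.AlmostCommutativeRing
  using (_-Raw-AlmostCommutative⟶_; fromCommutativeRing)
import Algebra.Solver.Ring.NaturalCoefficients as NaturalCoefficients
open import Data.Empty using (⊥; ⊥-elim)
open import Data.Maybe using (Maybe; just; nothing)
open import Data.Nat as ℕ using (ℕ; zero; suc; _≤_)
open import Data.Product using (∃; _×_; _,_; proj₁; proj₂)
open import Data.Sum using (_⊎_; inj₁; inj₂)
open import Level using (_⊔_)
open import Relation.Binary.PropositionalEquality as ≡ using (_≡_)
open import Relation.Nullary using (¬_; yes; no)

module CommutativeRingSolver {c ℓ} (F : CommutativeRing c ℓ) where
  open CommutativeRing F
  open import Relation.Binary.Reasoning.Setoid setoid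
  open import Algebra.Properties.Ring ring
    using (-‿distribˡ-*; -‿distribʳ-*; -‿involutive; -0#≈0#; -‿+-comm)
  open import Algebra.Properties.Semiring.Mult semiring
    using (×-homo-+; ×1-homo-*) renaming (_×_ to _×ᵤ_)

  ι : ℕ → Carrier
  ι k = k ×ᵤ 1#

  decℕ : ∀ m n → Maybe (ι m ≈ ι n)
  decℕ m n with m ℕ.≟ n
  ... | yes ≡.refl = just refl
  ... | no _       = nothing

  open NaturalCoefficients commutativeSemiring decℕ
    using () renaming (solve to solveₙ; _:=_ to _:=ₙ_; _:+_ to _:+ₙ_; _:*_ to _:*ₙ_)

  -- coefficients: a pair (a , b) of naturals stands for the integer a - b
  ℤPairs : RawRing _ _
  ℤPairs = record
    { Carrier = ℕ × ℕ ; _≈_ = _≡_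
    ; _+_ = λ { (a , b) (a' , b') → (a ℕ.+ a' , b ℕ.+ b') }
    ; _*_ = λ { (a , b) (a' , b') → (a ℕ.* a' ℕ.+ b ℕ.* b' , a ℕ.* b' ℕ.+ b ℕ.* a') }
    ; -_ = λ { (a , b) → (b , a) }
    ; 0# = (0 , 0) ; 1# = (1 , 0) }

  -- interpretation of coefficients; 0 and 1 are sent to 0# and 1# on the nose,
  -- so that identities stated with 0# and 1# are literally the solver's output
  ⟦_⟧ᶜ : ℕ × ℕ → Carrier
  ⟦ zero , zero ⟧ᶜ = 0#
  ⟦ suc zero , zero ⟧ᶜ = 1#
  ⟦ a , b ⟧ᶜ = ι a - ι b

  ⟦⟧ᶜ-≈ : ∀ a b → ⟦ a , b ⟧ᶜ ≈ ι a - ι b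
  ⟦⟧ᶜ-≈ zero zero = sym (trans (+-congˡ -0#≈0#) (+-identityʳ _))
  ⟦⟧ᶜ-≈ (suc zero) zero = sym (trans (+-congˡ -0#≈0#) (trans (+-identityʳ _) (+-identityʳ _)))
  ⟦⟧ᶜ-≈ zero (suc b) = refl
  ⟦⟧ᶜ-≈ (suc zero) (suc b) = refl
  ⟦⟧ᶜ-≈ (suc (suc a)) b = refl

  -‿-‿* : ∀ x y → - x * - y ≈ x * y
  -‿-‿* x y = trans (sym (-‿distribˡ-* x (- y))) (trans (-‿cong (sym (-‿distribʳ-* x y))) (-‿involutive _))

  diff-+ : ∀ a b a' b' → ι (a ℕ.+ a') - ι (b ℕ.+ b') ≈ (ι a - ι b) + (ι a' - ι b')
  diff-+ a b a' b' = begin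
    ι (a ℕ.+ a') - ι (b ℕ.+ b')       ≈⟨ +-cong (×-homo-+ 1# a a') (-‿cong (×-homo-+ 1# b b')) ⟩
    (ι a + ι a') + - (ι b + ι b')     ≈⟨ +-congˡ (sym (-‿+-comm _ _)) ⟩
    (ι a + ι a') + (- ι b + - ι b')   ≈⟨ solveₙ 4 (λ x x' y y' → (x :+ₙ x') :+ₙ (y :+ₙ y') :=ₙ (x :+ₙ y) :+ₙ (x' :+ₙ y'))
                                           refl (ι a) (ι a') (- ι b) (- ι b') ⟩
    (ι a - ι b) + (ι a' - ι b')       ∎

  diff-* : ∀ a b a' b' →
           ι (a ℕ.* a' ℕ.+ b ℕ.* b') - ι (a ℕ.* b' ℕ.+ b ℕ.* a') ≈ (ι a - ι b) * (ι a' - ι b')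
  diff-* a b a' b' = begin
    ι (a ℕ.* a' ℕ.+ b ℕ.* b') - ι (a ℕ.* b' ℕ.+ b ℕ.* a')
      ≈⟨ +-cong (trans (×-homo-+ 1# (a ℕ.* a') (b ℕ.* b')) (+-cong (×1-homo-* a a') (×1-homo-* b b')))
                (-‿cong (trans (×-homo-+ 1# (a ℕ.* b') (b ℕ.* a')) (+-cong (×1-homo-* a b') (×1-homo-* b a')))) ⟩
    (A * A' + B * B') + - (A * B' + B * A')      ≈⟨ +-congˡ (sym (-‿+-comm _ _)) ⟩
    (A * A' + B * B') + (- (A * B') + - (B * A')) ≈⟨ +-cong (+-congˡ (sym (-‿-‿* B B')))
                                                            (+-cong (-‿distribʳ-* A B') (-‿distribˡ-* B A')) ⟩
    (A * A' + - B * - B') + (A * - B' + - B * A')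
      ≈⟨ solveₙ 4 (λ x x' y y' → (x :*ₙ x' :+ₙ y :*ₙ y') :+ₙ (x :*ₙ y' :+ₙ y :*ₙ x') :=ₙ (x :+ₙ y) :*ₙ (x' :+ₙ y'))
                refl A A' (- B) (- B') ⟩
    (A - B) * (A' - B') ∎
    where A = ι a ; B = ι b ; A' = ι a' ; B' = ι b'

  diff-swap : ∀ x y → y - x ≈ - (x - y)
  diff-swap x y = begin
    y - x        ≈⟨ +-comm _ _ ⟩
    - x + y      ≈⟨ +-congˡ (sym (-‿involutive y)) ⟩
    - x + - - y  ≈⟨ -‿+-comm x (- y) ⟩
    - (x - y)    ∎

  ℤPairs⟶F : ℤPairs -Raw-AlmostCommutative⟶ fromCommutativeRing F
  ℤPairs⟶F = record
    { ⟦_⟧ = ⟦_⟧ᶜ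
    ; +-homo = λ { (a , b) (a' , b') → trans (⟦⟧ᶜ-≈ (a ℕ.+ a') (b ℕ.+ b')) (trans (diff-+ a b a' b') (sym (+-cong (⟦⟧ᶜ-≈ a b) (⟦⟧ᶜ-≈ a' b')))) }
    ; *-homo = λ { (a , b) (a' , b') → trans (⟦⟧ᶜ-≈ (a ℕ.* a' ℕ.+ b ℕ.* b') (a ℕ.* b' ℕ.+ b ℕ.* a')) (trans (diff-* a b a' b') (sym (*-cong (⟦⟧ᶜ-≈ a b) (⟦⟧ᶜ-≈ a' b')))) }
    ; -‿homo = λ { (a , b) → trans (⟦⟧ᶜ-≈ b a) (trans (diff-swap (ι a) (ι b)) (-‿cong (sym (⟦⟧ᶜ-≈ a b)))) }
    ; 0-homo = refl
    ; 1-homo = refl }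

  diff-cong : ∀ x y z w → x + w ≈ z + y → x - y ≈ z - w
  diff-cong x y z w h = begin
    x - y                ≈⟨ sym (+-identityʳ _) ⟩
    (x - y) + 0#         ≈⟨ +-congˡ (sym (-‿inverseʳ w)) ⟩
    (x - y) + (w - w)    ≈⟨ solveₙ 4 (λ a b c d → (a :+ₙ b) :+ₙ (c :+ₙ d) :=ₙ (a :+ₙ c) :+ₙ (b :+ₙ d)) refl x (- y) w (- w) ⟩
    (x + w) + (- y - w)  ≈⟨ +-congʳ h ⟩
    (z + y) + (- y - w)  ≈⟨ solveₙ 4 (λ a b c d → (a :+ₙ b) :+ₙ (c :+ₙ d) :=ₙ (a :+ₙ d) :+ₙ (b :+ₙ c)) refl z y (- y) (- w) ⟩
    (z - w) + (y - y)    ≈⟨ +-congˡ (-‿inverseʳ y) ⟩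
    (z - w) + 0#         ≈⟨ +-identityʳ _ ⟩
    z - w                ∎

  decᶜ : ∀ x y → Maybe (⟦ x ⟧ᶜ ≈ ⟦ y ⟧ᶜ)
  decᶜ (a , b) (a' , b') with (a ℕ.+ b') ℕ.≟ (a' ℕ.+ b)
  ... | yes e = just (trans (⟦⟧ᶜ-≈ a b) (trans (diff-cong (ι a) (ι b) (ι a') (ι b')
                  (trans (sym (×-homo-+ 1# a b')) (trans (reflexive (≡.cong ι e)) (×-homo-+ 1# a' b))))
                  (sym (⟦⟧ᶜ-≈ a' b'))))
  ... | no _  = nothing

  open import Algebra.Solver.Ring ℤPairs (fromCommutativeRing F) ℤPairs⟶F decᶜ public
    using (Polynomial; solve; _:=_; _:+_; _:*_; :-_; _:-_; con)

  :0 :1 : ∀ {k} → Polynomial k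
  :0 = con (0 , 0)
  :1 = con (1 , 0)

module Valuation {c ℓ} (S : CDVR c ℓ) where
  open CDVR S
  open CommutativeRingSolver F using (solve; _:=_; _:+_; _:*_; :-_; _:-_; :0; :1)
  open import Relation.Binary.Reasoning.Setoid setoid

  *-cancelˡ : ∀ {x y z} → ¬ (x ≈ 0#) → x * y ≈ x * z → y ≈ z
  *-cancelˡ {x} {y} {z} x≉0 xy≈xz with inverse x x≉0
  ... | x⁻¹ , xx⁻¹≈1 = begin
    y                ≈⟨ solve 3 (λ x x' y → y := y :* :1) refl x x⁻¹ y ⟩
    y * 1#           ≈⟨ *-congˡ (sym xx⁻¹≈1) ⟩
    y * (x * x⁻¹)    ≈⟨ solve 3 (λ x x' y → y :* (x :* x') := x' :* (x :* y)) refl x x⁻¹ y ⟩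
    x⁻¹ * (x * y)    ≈⟨ *-congˡ xy≈xz ⟩
    x⁻¹ * (x * z)    ≈⟨ solve 3 (λ x x' z → x' :* (x :* z) := z :* (x :* x')) refl x x⁻¹ z ⟩
    z * (x * x⁻¹)    ≈⟨ *-congˡ xx⁻¹≈1 ⟩
    z * 1#           ≈⟨ *-identityʳ z ⟩
    z                ∎

  ^-cancelˡ : ∀ k {y z} → p ^ k * y ≈ p ^ k * z → y ≈ z
  ^-cancelˡ zero {y} {z} h = trans (sym (*-identityˡ y)) (trans h (*-identityˡ z))
  ^-cancelˡ (suc k) {y} {z} h =
    ^-cancelˡ k (*-cancelˡ p≉0 (trans (sym (*-assoc p (p ^ k) y)) (trans h (*-assoc p (p ^ k) z))))

  inR-^ : ∀ k → inR (p ^ k)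
  inR-^ zero    = inR-1
  inR-^ (suc k) = inR-* inR-p (inR-^ k)

  -- 1 + p t ≠ 0 for t ∈ R, since otherwise p (-t) = 1
  1+𝔭-nonzero : ∀ {x} t → inR t → x ≈ 1# + p * t → ¬ (x ≈ 0#)
  1+𝔭-nonzero {x} t t∈R x≈1+pt x≈0 = p-nonunit (- t , inR-neg t∈R , (begin
    p * - t           ≈⟨ solve 2 (λ p t → p :* (:- t) := :1 :- (:1 :+ p :* t)) refl p t ⟩
    1# - (1# + p * t) ≈⟨ +-congˡ (-‿cong (trans (sym x≈1+pt) x≈0)) ⟩
    1# - 0#           ≈⟨ solve 0 (:1 :- :0 := :1) refl ⟩
    1#                ∎))

  -- elements of 1 + 𝔭 are units of R: in the factorisation x = u pᵏ the exponent
  -- k must vanish, since otherwise p would divide 1 in R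
  1+𝔭-unit : ∀ {x} t → inR t → x ≈ 1# + p * t → ∃ λ w → inR w × x * w ≈ 1#
  1+𝔭-unit {x} t t∈R x≈1+pt = exponent-zero (factor x x∈R (1+𝔭-nonzero t t∈R x≈1+pt))
    where
    x∈R : inR x
    x∈R = inR-resp (sym x≈1+pt) (inR-+ inR-1 (inR-* inR-p t∈R))
    exponent-zero : (∃ λ k → ∃ λ u → inR u × (∃ λ v → inR v × u * v ≈ 1#) × x ≈ u * (p ^ k)) →
                    ∃ λ w → inR w × x * w ≈ 1#
    exponent-zero (zero , u , _ , (v , v∈R , uv≈1) , x≈u) =
      v , v∈R , trans (*-congʳ (trans x≈u (*-identityʳ u))) uv≈1
    exponent-zero (suc k , u , u∈R , _ , x≈upᵏ) = ⊥-elim (p-nonunit (u * p ^ k - t ,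
      inR-+ (inR-* u∈R (inR-^ k)) (inR-neg t∈R) , (begin
      p * (u * p ^ k - t)     ≈⟨ solve 4 (λ p u P t → p :* (u :* P :- t) := u :* (p :* P) :- p :* t) refl p u (p ^ k) t ⟩
      u * (p * p ^ k) - p * t ≈⟨ +-congʳ (sym x≈upᵏ) ⟩
      x - p * t               ≈⟨ +-congʳ x≈1+pt ⟩
      (1# + p * t) - p * t    ≈⟨ solve 2 (λ p t → (:1 :+ p :* t) :- p :* t := :1) refl p t ⟩
      1#                      ∎)))

  1∉𝔭 : ∀ k {x y z} → inR x → inR y → inR z → ¬ (p * x - y * (p ^ suc k * z) ≈ 1#)
  1∉𝔭 k {x} {y} {z} x∈R y∈R z∈R relation = p-nonunit (x - y * (p ^ k * z) ,
    inR-+ x∈R (inR-neg (inR-* y∈R (inR-* (inR-^ k) z∈R))) ,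
    trans (solve 5 (λ p P x y z → p :* (x :- y :* (P :* z)) := p :* x :- y :* ((p :* P) :* z)) refl p (p ^ k) x y z)
          relation)

module Order {c ℓ} (S : CDVR c ℓ) (n : ℕ) where
  open Setup S n
  open Valuation S
  open CommutativeRingSolver F using (solve; _:=_; _:+_; _:*_; :-_; _:-_; :0; :1)

  ∣R-resp : ∀ {x y y'} → y ≈ y' → x ∣R y → x ∣R y'
  ∣R-resp y≈y' (z , z∈R , y≈xz) = z , z∈R , trans (sym y≈y') y≈xz

  ∣R-0 : ∀ {x} → x ∣R 0#
  ∣R-0 {x} = 0# , inR-0 , sym (zeroʳ x)

  ∣R-+ : ∀ {x y y'} → x ∣R y → x ∣R y' → x ∣R (y + y')
  ∣R-+ {x} (z , z∈R , e) (z' , z'∈R , e') =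
    z + z' , inR-+ z∈R z'∈R , trans (+-cong e e') (sym (distribˡ x z z'))

  ∣R-*ˡ : ∀ {x y r} → inR r → x ∣R y → x ∣R (r * y)
  ∣R-*ˡ {x} {y} {r} r∈R (z , z∈R , e) =
    r * z , inR-* r∈R z∈R , trans (*-congˡ e) (solve 3 (λ r x z → r :* (x :* z) := x :* (r :* z)) refl r x z)

  ∣R-*ʳ : ∀ {x y r} → inR r → x ∣R y → x ∣R (y * r)
  ∣R-*ʳ r∈R d = ∣R-resp (*-comm _ _) (∣R-*ˡ r∈R d)

  ∣R-neg : ∀ {x y} → x ∣R y → x ∣R (- y)
  ∣R-neg {x} (z , z∈R , e) =
    - z , inR-neg z∈R , trans (-‿cong e) (solve 2 (λ x z → :- (x :* z) := x :* (:- z)) refl x z)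

  pⁿ∣R⇒inR : ∀ {x} → (p ^ n) ∣R x → inR x
  pⁿ∣R⇒inR (z , z∈R , x≈pⁿz) = inR-resp (sym x≈pⁿz) (inR-* (inR-^ n) z∈R)

  ≈M-refl : ∀ {x} → x ≈M x
  ≈M-refl {mat _ _ _ _} = refl , refl , refl , refl

  ≈M-sym : ∀ {x y} → x ≈M y → y ≈M x
  ≈M-sym {mat _ _ _ _} {mat _ _ _ _} (e₁ , e₂ , e₃ , e₄) = sym e₁ , sym e₂ , sym e₃ , sym e₄

  ≈M-trans : ∀ {x y z} → x ≈M y → y ≈M z → x ≈M z
  ≈M-trans {mat _ _ _ _} {mat _ _ _ _} {mat _ _ _ _} (e₁ , e₂ , e₃ , e₄) (f₁ , f₂ , f₃ , f₄) =
    trans e₁ f₁ , trans e₂ f₂ , trans e₃ f₃ , trans e₄ f₄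

  *M-cong : ∀ {x x' y y'} → x ≈M x' → y ≈M y' → (x *M y) ≈M (x' *M y')
  *M-cong {mat _ _ _ _} {mat _ _ _ _} {mat _ _ _ _} {mat _ _ _ _} (e₁ , e₂ , e₃ , e₄) (f₁ , f₂ , f₃ , f₄) =
    +-cong (*-cong e₁ f₁) (*-cong e₂ f₃) , +-cong (*-cong e₁ f₂) (*-cong e₂ f₄) ,
    +-cong (*-cong e₃ f₁) (*-cong e₄ f₃) , +-cong (*-cong e₃ f₂) (*-cong e₄ f₄)

  +M-cong : ∀ {x x' y y'} → x ≈M x' → y ≈M y' → (x +M y) ≈M (x' +M y')
  +M-cong {mat _ _ _ _} {mat _ _ _ _} {mat _ _ _ _} {mat _ _ _ _} (e₁ , e₂ , e₃ , e₄) (f₁ , f₂ , f₃ , f₄) =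
    +-cong e₁ f₁ , +-cong e₂ f₂ , +-cong e₃ f₃ , +-cong e₄ f₄

  *M-assoc : ∀ x y z → ((x *M y) *M z) ≈M (x *M (y *M z))
  *M-assoc (mat a₁ b₁ c₁ d₁) (mat a₂ b₂ c₂ d₂) (mat a₃ b₃ c₃ d₃) =
    entry a₁ b₁ a₃ c₃ , entry a₁ b₁ b₃ d₃ , entry c₁ d₁ a₃ c₃ , entry c₁ d₁ b₃ d₃
    where
    entry : ∀ x₁ x₂ z₁ z₂ → (x₁ * a₂ + x₂ * c₂) * z₁ + (x₁ * b₂ + x₂ * d₂) * z₂
                          ≈ x₁ * (a₂ * z₁ + b₂ * z₂) + x₂ * (c₂ * z₁ + d₂ * z₂)
    entry x₁ x₂ z₁ z₂ = solve 8 (λ x₁ x₂ a b c d z₁ z₂ →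
      (x₁ :* a :+ x₂ :* c) :* z₁ :+ (x₁ :* b :+ x₂ :* d) :* z₂ := x₁ :* (a :* z₁ :+ b :* z₂) :+ x₂ :* (c :* z₁ :+ d :* z₂))
      refl x₁ x₂ a₂ b₂ c₂ d₂ z₁ z₂

  *M-distribˡ : ∀ x y z → (x *M (y +M z)) ≈M ((x *M y) +M (x *M z))
  *M-distribˡ (mat a₁ b₁ c₁ d₁) (mat a₂ b₂ c₂ d₂) (mat a₃ b₃ c₃ d₃) =
    entry a₁ b₁ a₂ c₂ a₃ c₃ , entry a₁ b₁ b₂ d₂ b₃ d₃ , entry c₁ d₁ a₂ c₂ a₃ c₃ , entry c₁ d₁ b₂ d₂ b₃ d₃
    where
    entry : ∀ x₁ x₂ u₁ u₂ v₁ v₂ → x₁ * (u₁ + v₁) + x₂ * (u₂ + v₂) ≈ (x₁ * u₁ + x₂ * u₂) + (x₁ * v₁ + x₂ * v₂)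
    entry = solve 6 (λ x₁ x₂ u₁ u₂ v₁ v₂ →
      x₁ :* (u₁ :+ v₁) :+ x₂ :* (u₂ :+ v₂) := (x₁ :* u₁ :+ x₂ :* u₂) :+ (x₁ :* v₁ :+ x₂ :* v₂)) refl

  *M-distribʳ : ∀ x y z → ((y +M z) *M x) ≈M ((y *M x) +M (z *M x))
  *M-distribʳ (mat a₁ b₁ c₁ d₁) (mat a₂ b₂ c₂ d₂) (mat a₃ b₃ c₃ d₃) =
    entry a₁ c₁ a₂ b₂ a₃ b₃ , entry b₁ d₁ a₂ b₂ a₃ b₃ , entry a₁ c₁ c₂ d₂ c₃ d₃ , entry b₁ d₁ c₂ d₂ c₃ d₃
    where
    entry : ∀ x₁ x₂ u₁ u₂ v₁ v₂ → (u₁ + v₁) * x₁ + (u₂ + v₂) * x₂ ≈ (u₁ * x₁ + u₂ * x₂) + (v₁ * x₁ + v₂ * x₂)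
    entry = solve 6 (λ x₁ x₂ u₁ u₂ v₁ v₂ →
      (u₁ :+ v₁) :* x₁ :+ (u₂ :+ v₂) :* x₂ := (u₁ :* x₁ :+ u₂ :* x₂) :+ (v₁ :* x₁ :+ v₂ :* x₂)) refl

  *M-identityˡ : ∀ x → (1M *M x) ≈M x
  *M-identityˡ (mat a b c d) = top a c , top b d , bottom a c , bottom b d
    where
    top : ∀ u v → 1# * u + 0# * v ≈ u
    top = solve 2 (λ u v → :1 :* u :+ :0 :* v := u) refl
    bottom : ∀ u v → 0# * u + 1# * v ≈ v
    bottom = solve 2 (λ u v → :0 :* u :+ :1 :* v := v) refl

  *M-identityʳ : ∀ x → (x *M 1M) ≈M x
  *M-identityʳ (mat a b c d) = left a b , right a b , left c d , right c d
    where
    left : ∀ u v → u * 1# + v * 0# ≈ u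
    left = solve 2 (λ u v → u :* :1 :+ v :* :0 := u) refl
    right : ∀ u v → u * 0# + v * 1# ≈ v
    right = solve 2 (λ u v → u :* :0 :+ v :* :1 := v) refl

  *M-zeroˡ : ∀ x → (0M *M x) ≈M 0M
  *M-zeroˡ (mat a b c d) = entry a c , entry b d , entry a c , entry b d
    where
    entry : ∀ u v → 0# * u + 0# * v ≈ 0#
    entry = solve 2 (λ u v → :0 :* u :+ :0 :* v := :0) refl

  +M-identityˡ : ∀ x → (0M +M x) ≈M x
  +M-identityˡ (mat a b c d) = +-identityˡ a , +-identityˡ b , +-identityˡ c , +-identityˡ d

  +M-identityʳ : ∀ x → (x +M 0M) ≈M x
  +M-identityʳ (mat a b c d) = +-identityʳ a , +-identityʳ b , +-identityʳ c , +-identityʳ d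

  -M_ : M2 → M2
  -M (mat a b c d) = mat (- a) (- b) (- c) (- d)

  inO-resp : ∀ {x y} → x ≈M y → inO x → inO y
  inO-resp {mat _ _ _ _} {mat _ _ _ _} (e₁ , e₂ , e₃ , e₄) (a∈R , b∈R , pⁿ∣c , d∈R) =
    inR-resp e₁ a∈R , inR-resp e₂ b∈R , ∣R-resp e₃ pⁿ∣c , inR-resp e₄ d∈R

  inO-* : ∀ {x y} → inO x → inO y → inO (x *M y)
  inO-* {mat _ _ _ _} {mat _ _ _ _} (a₁ , b₁ , c₁ , d₁) (a₂ , b₂ , c₂ , d₂) =
    inR-+ (inR-* a₁ a₂) (inR-* b₁ (pⁿ∣R⇒inR c₂)) ,
    inR-+ (inR-* a₁ b₂) (inR-* b₁ d₂) ,
    ∣R-+ (∣R-*ʳ a₂ c₁) (∣R-*ˡ d₁ c₂) ,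
    inR-+ (inR-* (pⁿ∣R⇒inR c₁) b₂) (inR-* d₁ d₂)

  inO-+ : ∀ {x y} → inO x → inO y → inO (x +M y)
  inO-+ {mat _ _ _ _} {mat _ _ _ _} (a₁ , b₁ , c₁ , d₁) (a₂ , b₂ , c₂ , d₂) =
    inR-+ a₁ a₂ , inR-+ b₁ b₂ , ∣R-+ c₁ c₂ , inR-+ d₁ d₂

  inO-0M : inO 0M
  inO-0M = inR-0 , inR-0 , ∣R-0 , inR-0

  inO-1M : inO 1M
  inO-1M = inR-1 , inR-0 , ∣R-0 , inR-1

  inO-neg : ∀ {x} → inO x → inO (-M x)
  inO-neg {mat _ _ _ _} (a , b , c , d) = inR-neg a , inR-neg b , ∣R-neg c , inR-neg d

  nrd-cong : ∀ {x y} → x ≈M y → nrd x ≈ nrd y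
  nrd-cong {mat _ _ _ _} {mat _ _ _ _} (e₁ , e₂ , e₃ , e₄) = +-cong (*-cong e₁ e₄) (-‿cong (*-cong e₂ e₃))

  adj : M2 → M2
  adj (mat a b c d) = mat d (- b) (- c) a

  scalar : Carrier → M2
  scalar t = mat t 0# 0# t

  *M-adj : ∀ x → (x *M adj x) ≈M scalar (nrd x)
  *M-adj (mat a b c d) =
    solve 4 (λ a b c d → a :* d :+ b :* (:- c) := a :* d :- b :* c) refl a b c d ,
    solve 4 (λ a b c d → a :* (:- b) :+ b :* a := :0) refl a b c d ,
    solve 4 (λ a b c d → c :* d :+ d :* (:- c) := :0) refl a b c d ,
    solve 4 (λ a b c d → c :* (:- b) :+ d :* a := a :* d :- b :* c) refl a b c d

  multiple-*M-adj : ∀ {x α β} → x ≈M (β *M α) → (x *M adj α) ≈M (β *M scalar (nrd α))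
  multiple-*M-adj {x} {α} {β} x≈βα =
    ≈M-trans (*M-cong x≈βα (≈M-refl {adj α}))
             (≈M-trans (*M-assoc β α (adj α)) (*M-cong (≈M-refl {β}) (*M-adj α)))

  LeftInvertible : M2 → Set (c ⊔ ℓ)
  LeftInvertible y = ∃ λ u → inO u × (u *M y) ≈M 1M

  nrd-unit⇒left-invertible : ∀ {x} → inO x → (∃ λ w → inR w × nrd x * w ≈ 1#) → LeftInvertible x
  nrd-unit⇒left-invertible {mat a b c d} (a∈R , b∈R , pⁿ∣c , d∈R) (w , w∈R , Δw≈1) =
    mat (w * d) (- (w * b)) (- (w * c)) (w * a) ,
    (inR-* w∈R d∈R , inR-neg (inR-* w∈R b∈R) , ∣R-neg (∣R-*ˡ w∈R pⁿ∣c) , inR-* w∈R a∈R) ,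
    trans (solve 5 (λ a b c d w → (w :* d) :* a :+ (:- (w :* b)) :* c := (a :* d :- b :* c) :* w) refl a b c d w) Δw≈1 ,
    solve 5 (λ a b c d w → (w :* d) :* b :+ (:- (w :* b)) :* d := :0) refl a b c d w ,
    solve 5 (λ a b c d w → (:- (w :* c)) :* a :+ (w :* a) :* c := :0) refl a b c d w ,
    trans (solve 5 (λ a b c d w → (:- (w :* c)) :* b :+ (w :* a) :* d := (a :* d :- b :* c) :* w) refl a b c d w) Δw≈1

module Radical {c ℓ} (S : CDVR c ℓ) (n : ℕ) where
  open Setup S n
  open Valuation S
  open Order S n
  open CommutativeRingSolver F using (solve; _:=_; _:+_; _:*_; :-_; _:-_)

  rightTranslate : M2 → SubM (c ⊔ ℓ) → SubM (c ⊔ ℓ)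
  rightTranslate ω I z = I (z *M ω)

  cancelʳ : ∀ {ω ω'} → (ω *M ω') ≈M 1M → ∀ x → ((x *M ω) *M ω') ≈M x
  cancelʳ {ω} {ω'} ωω'≈1 x =
    ≈M-trans (*M-assoc x ω ω') (≈M-trans (*M-cong (≈M-refl {x}) ωω'≈1) (*M-identityʳ x))

  rightTranslate-leftIdeal : ∀ {ω ω'} → inO ω' → (ω *M ω') ≈M 1M →
                             ∀ I → LeftIdeal I → LeftIdeal (rightTranslate ω I)
  rightTranslate-leftIdeal {ω} {ω'} ω'∈O ωω'≈1 I (I⊆O , I-resp , I-0 , I-+ , I-*) =
    (λ x xω∈I → inO-resp (cancelʳ ωω'≈1 x) (inO-* (I⊆O _ xω∈I) ω'∈O)) ,
    (λ x y x≈y → I-resp _ _ (*M-cong x≈y ≈M-refl)) ,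
    I-resp _ _ (≈M-sym (*M-zeroˡ ω)) I-0 ,
    (λ x y xω∈I yω∈I → I-resp _ _ (≈M-sym (*M-distribʳ ω x y)) (I-+ _ _ xω∈I yω∈I)) ,
    (λ r x r∈O xω∈I → I-resp _ _ (≈M-sym (*M-assoc r x ω)) (I-* r (x *M ω) r∈O xω∈I))

  module ByUnit (ω ω' : M2) (ω∈O : inO ω) (ω'∈O : inO ω')
                (ωω'≈1 : (ω *M ω') ≈M 1M) (ω'ω≈1 : (ω' *M ω) ≈M 1M) where

    rightTranslate-maximal : ∀ I → MaximalLeftIdeal I → MaximalLeftIdeal (rightTranslate ω I)
    rightTranslate-maximal I (I-ideal@(_ , I-resp , _ , _ , I-*) , 1∉I , I-max) =
      rightTranslate-leftIdeal ω'∈O ωω'≈1 I I-ideal , ω∉I , maximal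
      where
      ω∉I : ¬ I (1M *M ω)
      ω∉I ω∈I = 1∉I (I-resp _ _ (≈M-trans (*M-cong (≈M-refl {ω'}) (*M-identityˡ ω)) ω'ω≈1) (I-* ω' _ ω'∈O ω∈I))
      maximal : ∀ J → LeftIdeal J → (∀ x → rightTranslate ω I x → J x) → (J ≐ rightTranslate ω I) ⊎ J 1M
      maximal J J-ideal@(_ , J-resp , _ , _ , J-*) I⊆J =
        pull-back (I-max (rightTranslate ω' J) (rightTranslate-leftIdeal ω∈O ω'ω≈1 J J-ideal)
                         (λ x x∈I → I⊆J (x *M ω') (I-resp _ _ (≈M-sym (cancelʳ ω'ω≈1 x)) x∈I)))
        where
        pull-back : (rightTranslate ω' J ≐ I) ⊎ rightTranslate ω' J 1M → (J ≐ rightTranslate ω I) ⊎ J 1M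
        pull-back (inj₁ Jω≐I) =
          inj₁ (λ x → (λ x∈J → proj₁ (Jω≐I (x *M ω)) (J-resp _ _ (≈M-sym (cancelʳ ωω'≈1 x)) x∈J)) , I⊆J x)
        pull-back (inj₂ ω'∈J) =
          inj₂ (J-resp _ _ (≈M-trans (*M-cong (≈M-refl {ω}) (*M-identityˡ ω')) ωω'≈1) (J-* ω _ ω∈O ω'∈J))

    rad-*unit : ∀ y → rad y → rad (y *M ω)
    rad-*unit y (y∈O , y∈max) = inO-* y∈O ω∈O , λ I I-max → y∈max (rightTranslate ω I) (rightTranslate-maximal I I-max)

  rad-resp : ∀ {x y} → x ≈M y → rad x → rad y
  rad-resp x≈y (x∈O , x∈max) = inO-resp x≈y x∈O , y∈max
    where
    y∈max : ∀ I → MaximalLeftIdeal I → I _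
    y∈max I I-max@((_ , I-resp , _) , _) = I-resp _ _ x≈y (x∈max I I-max)

  σ-rad : ∀ ω → unitO ω → σ ω rad ≐ rad
  σ-rad ω (ω∈O , ω' , ω'∈O , ωω'≈1 , ω'ω≈1) x =
    (λ { (y , y∈rad , x≈yω) → rad-resp (≈M-sym x≈yω) (byω.rad-*unit y y∈rad) }) ,
    (λ x∈rad → x *M ω' , byω'.rad-*unit x x∈rad , ≈M-sym (cancelʳ ω'ω≈1 x))
    where
    module byω  = ByUnit ω ω' ω∈O ω'∈O ωω'≈1 ω'ω≈1
    module byω' = ByUnit ω' ω ω'∈O ω∈O ω'ω≈1 ωω'≈1

  +M-regroup : ∀ i r i' r' x → ((i +M (r *M x)) +M (i' +M (r' *M x))) ≈M ((i +M i') +M ((r +M r') *M x))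
  +M-regroup (mat i₁ i₂ i₃ i₄) (mat r₁ r₂ r₃ r₄) (mat j₁ j₂ j₃ j₄) (mat s₁ s₂ s₃ s₄) (mat a b c d) =
    entry i₁ r₁ a r₂ c j₁ s₁ s₂ , entry i₂ r₁ b r₂ d j₂ s₁ s₂ ,
    entry i₃ r₃ a r₄ c j₃ s₃ s₄ , entry i₄ r₃ b r₄ d j₄ s₃ s₄
    where
    entry : ∀ i r u r' v i' s s' → (i + (r * u + r' * v)) + (i' + (s * u + s' * v))
                                 ≈ (i + i') + ((r + s) * u + (r' + s') * v)
    entry = solve 8 (λ i r u r' v i' s s' → (i :+ (r :* u :+ r' :* v)) :+ (i' :+ (s :* u :+ s' :* v))
                                       := (i :+ i') :+ ((r :+ s) :* u :+ (r' :+ s') :* v)) refl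

  _+𝒪_ : SubM (c ⊔ ℓ) → M2 → SubM (c ⊔ ℓ)
  (I +𝒪 x) y = ∃ λ i → ∃ λ r → I i × inO r × y ≈M (i +M (r *M x))

  +𝒪-leftIdeal : ∀ I x → inO x → LeftIdeal I → LeftIdeal (I +𝒪 x)
  +𝒪-leftIdeal I x x∈O (I⊆O , I-resp , I-0 , I-+ , I-*) =
    (λ { y (i , r , i∈I , r∈O , y≈) → inO-resp (≈M-sym y≈) (inO-+ (I⊆O i i∈I) (inO-* r∈O x∈O)) }) ,
    (λ { y y' y≈y' (i , r , i∈I , r∈O , y≈) → i , r , i∈I , r∈O , ≈M-trans (≈M-sym y≈y') y≈ }) ,
    (0M , 0M , I-0 , inO-0M , ≈M-sym (≈M-trans (+M-identityˡ _) (*M-zeroˡ x))) ,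
    (λ { y y' (i , r , i∈I , r∈O , y≈) (i' , r' , i'∈I , r'∈O , y'≈) →
         i +M i' , r +M r' , I-+ _ _ i∈I i'∈I , inO-+ r∈O r'∈O , ≈M-trans (+M-cong y≈ y'≈) (+M-regroup i r i' r' x) }) ,
    (λ { s y s∈O (i , r , i∈I , r∈O , y≈) →
         s *M i , s *M r , I-* s i s∈O i∈I , inO-* s∈O r∈O ,
         ≈M-trans (*M-cong (≈M-refl {s}) y≈)
           (≈M-trans (*M-distribˡ s i (r *M x)) (+M-cong (≈M-refl {s *M i}) (≈M-sym (*M-assoc s r x)))) })

  1M-split : ∀ i r x → 1M ≈M (i +M (r *M x)) → i ≈M (1M +M ((-M r) *M x))
  1M-split (mat i₁ i₂ i₃ i₄) (mat r₁ r₂ r₃ r₄) (mat a b c d) (e₁ , e₂ , e₃ , e₄) =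
    entry e₁ , entry e₂ , entry e₃ , entry e₄
    where
    entry : ∀ {o i r u r' v} → o ≈ i + (r * u + r' * v) → i ≈ o + (- r * u + - r' * v)
    entry {o} {i} {r} {u} {r'} {v} o≈ = trans
      (solve 5 (λ i r u r' v → i := (i :+ (r :* u :+ r' :* v)) :+ ((:- r) :* u :+ (:- r') :* v)) refl i r u r' v)
      (+-congʳ (sym o≈))

  -- x ∈ rad(𝒪) as soon as 1 + r x is left invertible in 𝒪 for every r ∈ 𝒪:
  -- for a maximal left ideal I, either I + 𝒪x = I, or 1 = i + r x with i ∈ I, and then
  -- i = 1 + (-r) x is left invertible, forcing 1 ∈ I
  rad-criterion : ∀ x → inO x → (∀ r → inO r → LeftInvertible (1M +M (r *M x))) → rad x
  rad-criterion x x∈O 1+𝒪x-invertible = x∈O , x∈max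
    where
    x∈max : ∀ I → MaximalLeftIdeal I → I x
    x∈max I (I-ideal@(_ , I-resp , I-0 , _ , I-*) , 1∉I , I-max) =
      alternatives (I-max (I +𝒪 x) (+𝒪-leftIdeal I x x∈O I-ideal)
                          (λ y y∈I → y , 0M , y∈I , inO-0M ,
                                     ≈M-sym (≈M-trans (+M-cong (≈M-refl {y}) (*M-zeroˡ x)) (+M-identityʳ y))))
      where
      1∉I+𝒪x : ∀ i r → I i → inO r → 1M ≈M (i +M (r *M x)) → ⊥
      1∉I+𝒪x i r i∈I r∈O 1≈i+rx =
        let (u , u∈O , u[1-rx]≈1) = 1+𝒪x-invertible (-M r) (inO-neg r∈O) in
        1∉I (I-resp _ _ (≈M-trans (*M-cong (≈M-refl {u}) (1M-split i r x 1≈i+rx)) u[1-rx]≈1) (I-* u i u∈O i∈I))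
      alternatives : ((I +𝒪 x) ≐ I) ⊎ (I +𝒪 x) 1M → I x
      alternatives (inj₁ I+𝒪x≐I) =
        proj₁ (I+𝒪x≐I x) (0M , 1M , I-0 , inO-1M , ≈M-sym (≈M-trans (+M-identityˡ _) (*M-identityˡ x)))
      alternatives (inj₂ (i , r , i∈I , r∈O , 1≈i+rx)) = ⊥-elim (1∉I+𝒪x i r i∈I r∈O 1≈i+rx)

  rad-by-nrd : ∀ x → inO x → (∀ r → inO r → ∃ λ t → inR t × nrd (1M +M (r *M x)) ≈ 1# + p * t) → rad x
  rad-by-nrd x x∈O nrd∈1+𝔭 = rad-criterion x x∈O λ r r∈O →
    let (t , t∈R , nrd≈) = nrd∈1+𝔭 r r∈O in
    nrd-unit⇒left-invertible (inO-+ inO-1M (inO-* r∈O x∈O)) (1+𝔭-unit t t∈R nrd≈)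

module Generator {c ℓ} (S : CDVR c ℓ) (m : ℕ) where
  open Setup S (suc m)
  open Valuation S
  open Order S (suc m)
  open Radical S (suc m)
  open CommutativeRingSolver F using (solve; _:=_; _:+_; _:*_; :-_; _:-_; :0; :1)
  open import Relation.Binary.Reasoning.Setoid setoid

  e₁ e₂ : M2
  e₁ = mat 0# 1# 0# 0#
  e₂ = mat 0# 0# (p ^ suc m) 0#

  -- nrd(1 + r e₁) = 1 + r₃ with r₃ ∈ pⁿR ⊆ 𝔭
  e₁∈rad : rad e₁
  e₁∈rad = rad-by-nrd e₁ (inR-0 , inR-1 , ∣R-0 , inR-0) nrd∈1+𝔭
    where
    nrd∈1+𝔭 : ∀ r → inO r → ∃ λ t → inR t × nrd (1M +M (r *M e₁)) ≈ 1# + p * t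
    nrd∈1+𝔭 (mat r₁ r₂ r₃ r₄) (_ , _ , (z , z∈R , r₃≈pⁿz) , _) = p ^ m * z , inR-* (inR-^ m) z∈R , (begin
      nrd (1M +M (mat r₁ r₂ r₃ r₄ *M e₁))
        ≈⟨ solve 4 (λ r₁ r₂ r₃ r₄ → (:1 :+ (r₁ :* :0 :+ r₂ :* :0)) :* (:1 :+ (r₃ :* :1 :+ r₄ :* :0))
                                   :- (:0 :+ (r₁ :* :1 :+ r₂ :* :0)) :* (:0 :+ (r₃ :* :0 :+ r₄ :* :0))
                                   := :1 :+ r₃) refl r₁ r₂ r₃ r₄ ⟩
      1# + r₃                 ≈⟨ +-congˡ (trans r₃≈pⁿz (*-assoc p (p ^ m) z)) ⟩
      1# + p * (p ^ m * z)    ∎)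

  -- nrd(1 + r e₂) = 1 + r₂ pⁿ
  e₂∈rad : rad e₂
  e₂∈rad = rad-by-nrd e₂ (inR-0 , inR-0 , (1# , inR-1 , sym (*-identityʳ _)) , inR-0) nrd∈1+𝔭
    where
    nrd∈1+𝔭 : ∀ r → inO r → ∃ λ t → inR t × nrd (1M +M (r *M e₂)) ≈ 1# + p * t
    nrd∈1+𝔭 (mat r₁ r₂ r₃ r₄) (_ , r₂∈R , _) = r₂ * p ^ m , inR-* r₂∈R (inR-^ m) ,
      solve 6 (λ r₁ r₂ r₃ r₄ p P → (:1 :+ (r₁ :* :0 :+ r₂ :* (p :* P))) :* (:1 :+ (r₃ :* :0 :+ r₄ :* :0))
                                   :- (:0 :+ (r₁ :* :0 :+ r₂ :* :0)) :* (:0 :+ (r₃ :* :0 :+ r₄ :* (p :* P)))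
                                   := :1 :+ p :* (r₂ :* P)) refl r₁ r₂ r₃ r₄ p (p ^ m)

  GeneratorShape : M2 → Set (c ⊔ ℓ)
  GeneratorShape α = ∃ λ a' → ∃ λ b' → ∃ λ c₀ → ∃ λ d' → inR a' × inR b' × inR c₀ × inR d' ×
                     α ≈M mat (a' * p) b' (p ^ suc m * c₀) (d' * p)

  -- write e₁ = β α and e₂ = β' α; the (1,2) entry of e₁ adj α = p β gives p ∣ a,
  -- the (2,1) entry of e₂ adj α = p β' gives pⁿ d = p pⁿ z, i.e. p ∣ d
  generator-shape : ∀ α → GeneratesWithNormP rad α → GeneratorShape α
  generator-shape (mat a b c d) ((_ , b∈R , (c₀ , c₀∈R , c≈pⁿc₀) , _) , nrd≈p , rad≐Oα) =
    from-multiples (proj₁ (rad≐Oα e₁) e₁∈rad) (proj₁ (rad≐Oα e₂) e₂∈rad)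
    where
    from-multiples : Oα (mat a b c d) e₁ → Oα (mat a b c d) e₂ → GeneratorShape (mat a b c d)
    from-multiples (mat β₁ β₂ β₃ β₄ , (_ , β₂∈R , _) , e₁≈βα)
                   (mat β₁' β₂' β₃' β₄' , (_ , _ , (z , z∈R , β₃'≈pⁿz) , _) , e₂≈β'α) =
      β₂ , b , c₀ , z , β₂∈R , b∈R , c₀∈R , z∈R , a≈β₂p , refl , c≈pⁿc₀ , ^-cancelˡ (suc m) pⁿd≈pⁿzp
      where
      a≈β₂p : a ≈ β₂ * p
      a≈β₂p = begin
        a                      ≈⟨ solve 2 (λ a b → a := :0 :* (:- b) :+ :1 :* a) refl a b ⟩
        0# * - b + 1# * a      ≈⟨ proj₁ (proj₂ (multiple-*M-adj e₁≈βα)) ⟩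
        β₁ * 0# + β₂ * nrd (mat a b c d) ≈⟨ +-congˡ (*-congˡ nrd≈p) ⟩
        β₁ * 0# + β₂ * p       ≈⟨ solve 3 (λ x y p → x :* :0 :+ y :* p := y :* p) refl β₁ β₂ p ⟩
        β₂ * p                 ∎
      pⁿd≈pⁿzp : p ^ suc m * d ≈ p ^ suc m * (z * p)
      pⁿd≈pⁿzp = begin
        p ^ suc m * d          ≈⟨ solve 3 (λ P c d → P :* d := P :* d :+ :0 :* (:- c)) refl (p ^ suc m) c d ⟩
        p ^ suc m * d + 0# * - c ≈⟨ proj₁ (proj₂ (proj₂ (multiple-*M-adj e₂≈β'α))) ⟩
        β₃' * nrd (mat a b c d) + β₄' * 0# ≈⟨ +-congʳ (*-cong β₃'≈pⁿz nrd≈p) ⟩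
        (p ^ suc m * z) * p + β₄' * 0# ≈⟨ solve 4 (λ P z p y → (P :* z) :* p :+ y :* :0 := P :* (z :* p)) refl (p ^ suc m) z p β₄' ⟩
        p ^ suc m * (z * p)    ∎

  shape-relation : ∀ {a' b' c₀ d'} → nrd (mat (a' * p) b' (p ^ suc m * c₀) (d' * p)) ≈ p →
                   p * (a' * d') - b' * (p ^ m * c₀) ≈ 1#
  shape-relation {a'} {b'} {c₀} {d'} nrd≈p = *-cancelˡ p≉0 (begin
    p * (p * (a' * d') - b' * (p ^ m * c₀))
      ≈⟨ solve 6 (λ p P a' b' c₀ d' → p :* (p :* (a' :* d') :- b' :* (P :* c₀))
                                    := (a' :* p) :* (d' :* p) :- b' :* ((p :* P) :* c₀)) refl p (p ^ m) a' b' c₀ d' ⟩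
    nrd (mat (a' * p) b' (p ^ suc m * c₀) (d' * p)) ≈⟨ nrd≈p ⟩
    p                                               ≈⟨ sym (*-identityʳ p) ⟩
    p * 1#                                          ∎)

module Lattices {c ℓ} (S : CDVR c ℓ) (n : ℕ) where
  open Setup S n
  open Order S n
  open CommutativeRingSolver F using (solve; _:=_; _:+_; _:*_; :0; :1)

  ≈V-refl : ∀ v → v ≈V v
  ≈V-refl (_ , _) = refl , refl

  ≈V-sym : ∀ {v w} → v ≈V w → w ≈V v
  ≈V-sym {_ , _} {_ , _} (e₁ , e₂) = sym e₁ , sym e₂

  ≈V-trans : ∀ {u v w} → u ≈V v → v ≈V w → u ≈V w
  ≈V-trans {_ , _} {_ , _} {_ , _} (e₁ , e₂) (f₁ , f₂) = trans e₁ f₁ , trans e₂ f₂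

  ·-cong : ∀ {v v' A B} → v ≈V v' → A ≈M B → (v · A) ≈V (v' · B)
  ·-cong {_ , _} {_ , _} {mat _ _ _ _} {mat _ _ _ _} (e₁ , e₂) (f₁ , f₂ , f₃ , f₄) =
    +-cong (*-cong e₁ f₁) (*-cong e₂ f₃) , +-cong (*-cong e₁ f₂) (*-cong e₂ f₄)

  ·-assoc : ∀ v A B → ((v · A) · B) ≈V (v · (A *M B))
  ·-assoc (x , y) (mat a₁ b₁ c₁ d₁) (mat a₂ b₂ c₂ d₂) = entry a₂ c₂ , entry b₂ d₂
    where
    entry : ∀ u w → (x * a₁ + y * c₁) * u + (x * b₁ + y * d₁) * w ≈ x * (a₁ * u + b₁ * w) + y * (c₁ * u + d₁ * w)
    entry u w = solve 8 (λ x y a b c d u w → (x :* a :+ y :* c) :* u :+ (x :* b :+ y :* d) :* w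
                                           := x :* (a :* u :+ b :* w) :+ y :* (c :* u :+ d :* w))
                        refl x y a₁ b₁ c₁ d₁ u w

  ·-identity : ∀ v → (v · 1M) ≈V v
  ·-identity (x , y) = solve 2 (λ x y → x :* :1 :+ y :* :0 := x) refl x y ,
                       solve 2 (λ x y → x :* :0 :+ y :* :1 := y) refl x y

  _≅_ : Lat → Lat → Set (c ⊔ ℓ)
  L ≅ L' = ∀ w → (L w → L' w) × (L' w → L w)

  ≅-sym : ∀ {L L'} → L ≅ L' → L' ≅ L
  ≅-sym L≅L' w = proj₂ (L≅L' w) , proj₁ (L≅L' w)

  ≅-trans : ∀ {L L' L''} → L ≅ L' → L' ≅ L'' → L ≅ L''
  ≅-trans L≅L' L'≅L'' w = (λ h → proj₁ (L'≅L'' w) (proj₁ (L≅L' w) h)) , (λ h → proj₂ (L≅L' w) (proj₂ (L'≅L'' w) h))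

  ·L-cong : ∀ L {A B} → A ≈M B → (L ·L A) ≅ (L ·L B)
  ·L-cong L A≈B w =
    (λ { (v , v∈L , w≈vA) → v , v∈L , ≈V-trans w≈vA (·-cong (≈V-refl v) A≈B) }) ,
    (λ { (v , v∈L , w≈vB) → v , v∈L , ≈V-trans w≈vB (·-cong (≈V-refl v) (≈M-sym A≈B)) })

  ·L-resp : ∀ L M {w w'} → w ≈V w' → (L ·L M) w → (L ·L M) w'
  ·L-resp L M w≈w' (v , v∈L , w≈vM) = v , v∈L , ≈V-trans (≈V-sym w≈w') w≈vM

  L₀-closed : ∀ {v M} → inO M → L₀ v → L₀ (v · M)
  L₀-closed {_ , _} {mat _ _ _ _} (a∈R , b∈R , pⁿ∣c , d∈R) (x∈R , y∈R) =
    inR-+ (inR-* x∈R a∈R) (inR-* y∈R (pⁿ∣R⇒inR pⁿ∣c)) , inR-+ (inR-* x∈R b∈R) (inR-* y∈R d∈R)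

  L₀-unit-invariant : ∀ {ε} → inO ε → LeftInvertible ε → ∀ M → (L₀ ·L (ε *M M)) ≅ (L₀ ·L M)
  L₀-unit-invariant {ε} ε∈O (ε' , ε'∈O , ε'ε≈1) M w =
    (λ { (v , v∈L₀ , w≈v[εM]) → v · ε , L₀-closed ε∈O v∈L₀ , ≈V-trans w≈v[εM] (≈V-sym (·-assoc v ε M)) }) ,
    (λ { (v , v∈L₀ , w≈vM) → v · ε' , L₀-closed ε'∈O v∈L₀ , ≈V-trans w≈vM (≈V-sym (v≈[vε'ε] v M)) })
    where
    v≈[vε'ε] : ∀ v M → ((v · ε') · (ε *M M)) ≈V (v · M)
    v≈[vε'ε] v M = ≈V-trans (≈V-sym (·-assoc (v · ε') ε M))
                     (·-cong (≈V-trans (·-assoc v ε' ε) (≈V-trans (·-cong (≈V-refl v) ε'ε≈1) (·-identity v))) (≈M-refl {M}))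

  ≅⇒sameClass : ∀ {L L'} → (∀ {w w'} → w ≈V w' → L' w → L' w') → L ≅ L' → SameClass L L'
  ≅⇒sameClass {L} {L'} L'-resp L≅L' = 1# , 1≉0 , λ w →
    (λ w∈L' → w , proj₂ (L≅L' w) w∈L' , ≈V-sym (·s-identity w)) ,
    (λ { (v , v∈L , w≈v1) → L'-resp (≈V-sym (≈V-trans w≈v1 (·s-identity v))) (proj₁ (L≅L' v) v∈L) })
    where
    ·s-identity : ∀ v → (v ·s 1#) ≈V v
    ·s-identity (x , y) = *-identityʳ x , *-identityʳ y

  sameClass-≅ˡ : ∀ {L L' L''} → L ≅ L'' → SameClass L L' → SameClass L'' L'
  sameClass-≅ˡ L≅L'' (t , t≉0 , L'≐Lt) = t , t≉0 , λ w →
    (λ w∈L' → let (v , v∈L , w≈vt) = proj₁ (L'≐Lt w) w∈L' in v , proj₁ (L≅L'' v) v∈L , w≈vt) ,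
    (λ { (v , v∈L'' , w≈vt) → proj₂ (L'≐Lt w) (v , proj₂ (L≅L'' v) v∈L'' , w≈vt) })

  scalar-sameClass : ∀ {t q} → t * q ≈ 1# → SameClass (L₀ ·L scalar t) L₀
  scalar-sameClass {t} {q} tq≈1 = q , q≉0 , λ w →
    (λ w∈L₀ → w · scalar t , (w , w∈L₀ , ≈V-refl (w · scalar t)) , ≈V-sym (v[t]q≈v w)) ,
    (λ { (v , (u , u∈L₀ , v≈u[t]) , w≈vq) →
         L₀-resp (≈V-sym (≈V-trans w≈vq (≈V-trans (·s-cong v≈u[t]) (v[t]q≈v u)))) u∈L₀ })
    where
    q≉0 : ¬ (q ≈ 0#)
    q≉0 q≈0 = 1≉0 (trans (sym tq≈1) (trans (*-congˡ q≈0) (zeroʳ t)))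
    v[t]q≈v : ∀ v → ((v · scalar t) ·s q) ≈V v
    v[t]q≈v (x , y) =
      trans (solve 4 (λ x y t q → (x :* t :+ y :* :0) :* q := x :* (t :* q)) refl x y t q) (trans (*-congˡ tq≈1) (*-identityʳ x)) ,
      trans (solve 4 (λ x y t q → (x :* :0 :+ y :* t) :* q := y :* (t :* q)) refl x y t q) (trans (*-congˡ tq≈1) (*-identityʳ y))
    ·s-cong : ∀ {v v'} → v ≈V v' → (v ·s q) ≈V (v' ·s q)
    ·s-cong {_ , _} {_ , _} (e₁ , e₂) = *-congʳ e₁ , *-congʳ e₂
    L₀-resp : ∀ {v w} → v ≈V w → L₀ v → L₀ w
    L₀-resp {_ , _} {_ , _} (e₁ , e₂) (x∈R , y∈R) = inR-resp e₁ x∈R , inR-resp e₂ y∈R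

-- For n = 1 the shape of a generator α gives factorisations α = ε γ and γ α = δ (p·1)
-- with ε = (b a' ; d'p c₀) and δ = (c₀ d' ; p a' b) of reduced norm −1, hence units of 𝒪.
-- So L₀α = L₀γ and L₀γα = p L₀: the pair ([L₀α], [L₀γα]) is the segment [L₀γ] — [L₀].
module Segment {c ℓ} (S : CDVR c ℓ) where
  open Setup S 1
  open Order S 1
  open Generator S 0
  open Lattices S 1
  open CommutativeRingSolver F using (solve; _:=_; _:+_; _:*_; :-_; _:-_; :0; :1)

  nrd≈-1⇒left-invertible : ∀ {x} → inO x → nrd x ≈ - 1# → LeftInvertible x
  nrd≈-1⇒left-invertible x∈O nrd≈-1 = nrd-unit⇒left-invertible x∈O
    (- 1# , inR-neg inR-1 , trans (*-congʳ nrd≈-1) (solve 0 ((:- :1) :* (:- :1) := :1) refl))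

  own-segment : ∀ α → GeneratesWithNormP rad α → CorrespondsToOwnSegment α
  own-segment α generates@(_ , nrd≈p , _) = segment-of-shape (generator-shape α generates)
    where
    segment-of-shape : GeneratorShape α → CorrespondsToOwnSegment α
    segment-of-shape (a' , b' , c₀ , d' , a'∈R , b'∈R , c₀∈R , d'∈R , α≈shape) =
      inj₂ (≅⇒sameClass (·L-resp L₀ γ) L₀α≅L₀γ , sameClass-≅ˡ (≅-sym L₀γα≅L₀p) (scalar-sameClass pq≈1))
      where
      unimodular : p * (a' * d') - b' * (1# * c₀) ≈ 1#
      unimodular = shape-relation (trans (sym (nrd-cong α≈shape)) nrd≈p)
      ε δ : M2
      ε = mat b' a' (d' * p) c₀
      δ = mat c₀ d' (p * a') b'
      ε∈O : inO ε
      ε∈O = b'∈R , a'∈R , (d' , d'∈R , solve 2 (λ p d → d :* p := (p :* :1) :* d) refl p d') , c₀∈R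
      δ∈O : inO δ
      δ∈O = c₀∈R , d'∈R , (a' , a'∈R , solve 2 (λ p a → p :* a := (p :* :1) :* a) refl p a') , b'∈R
      nrdε≈-1 : nrd ε ≈ - 1#
      nrdε≈-1 = trans (solve 5 (λ p a b c d → b :* c :- a :* (d :* p) := :- (p :* (a :* d) :- b :* (:1 :* c)))
                                refl p a' b' c₀ d') (-‿cong unimodular)
      nrdδ≈-1 : nrd δ ≈ - 1#
      nrdδ≈-1 = trans (solve 5 (λ p a b c d → c :* b :- d :* (p :* a) := :- (p :* (a :* d) :- b :* (:1 :* c)))
                                refl p a' b' c₀ d') (-‿cong unimodular)
      α≈εγ : α ≈M (ε *M γ)
      α≈εγ = ≈M-trans α≈shape
        ( solve 3 (λ p a b → a :* p := b :* :0 :+ a :* (p :* :1)) refl p a' b'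
        , solve 2 (λ a b → b := b :* :1 :+ a :* :0) refl a' b'
        , solve 3 (λ p c d → (p :* :1) :* c := (d :* p) :* :0 :+ c :* (p :* :1)) refl p c₀ d'
        , solve 3 (λ p c d → d :* p := (d :* p) :* :1 :+ c :* :0) refl p c₀ d' )
      γα≈δp : (γ *M α) ≈M (δ *M scalar p)
      γα≈δp = ≈M-trans (*M-cong (≈M-refl {γ}) α≈shape)
        ( solve 4 (λ p a c d → :0 :* (a :* p) :+ :1 :* ((p :* :1) :* c) := c :* p :+ d :* :0) refl p a' c₀ d'
        , solve 4 (λ p b c d → :0 :* b :+ :1 :* (d :* p) := c :* :0 :+ d :* p) refl p b' c₀ d'
        , solve 4 (λ p a b c → (p :* :1) :* (a :* p) :+ :0 :* ((p :* :1) :* c) := (p :* a) :* p :+ b :* :0) refl p a' b' c₀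
        , solve 4 (λ p a b d → (p :* :1) :* b :+ :0 :* (d :* p) := (p :* a) :* :0 :+ b :* p) refl p a' b' d' )
      L₀α≅L₀γ : (L₀ ·L α) ≅ (L₀ ·L γ)
      L₀α≅L₀γ = ≅-trans (·L-cong L₀ α≈εγ) (L₀-unit-invariant ε∈O (nrd≈-1⇒left-invertible ε∈O nrdε≈-1) γ)
      L₀γα≅L₀p : (L₀ ·L (γ *M α)) ≅ (L₀ ·L scalar p)
      L₀γα≅L₀p = ≅-trans (·L-cong L₀ γα≈δp) (L₀-unit-invariant δ∈O (nrd≈-1⇒left-invertible δ∈O nrdδ≈-1) (scalar p))
      pq≈1 : p * proj₁ (inverse p p≉0) ≈ 1#
      pq≈1 = proj₂ (inverse p p≉0)

module LevelAtLeastTwo {c ℓ} (S : CDVR c ℓ) (k : ℕ) where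
  open Setup S (suc (suc k))
  open Valuation S
  open Order S (suc (suc k))
  open Generator S (suc k)

  no-generator : ∀ α → ¬ GeneratesWithNormP rad α
  no-generator α generates@(_ , nrd≈p , _) = impossible (generator-shape α generates)
    where
    impossible : GeneratorShape α → ⊥
    impossible (a' , b' , c₀ , d' , a'∈R , b'∈R , c₀∈R , d'∈R , α≈shape) =
      1∉𝔭 k (inR-* a'∈R d'∈R) b'∈R c₀∈R (shape-relation (trans (sym (nrd-cong α≈shape)) nrd≈p))

corollary3p5 : ∀ {c ℓ} (S : CDVR c ℓ) (n : ℕ) → 1 ≤ n →
    let open Setup S n in
    InId rad →
    (∀ α → GeneratesWithNormP rad α → CorrespondsToOwnSegment α)
    × (∀ ω → unitO ω → σ ω rad ≐ rad)
corollary3p5 S 0 () _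
corollary3p5 S 1 _ _ = Segment.own-segment S , Radical.σ-rad S 1
corollary3p5 S (suc (suc k)) _ _ =
  (λ α generates → ⊥-elim (LevelAtLeastTwo.no-generator S k α generates)) , Radical.σ-rad S (suc (suc k))
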